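{- Let $\vdash_*$ be $\vdash_p$ plus additional axioms, and let $j$ be a nucleus on $\vdash_*$ (regarded as an entailment relation $\rhd$). (i) The rule R$\to$ (from $\Gamma,\varphi\vdash_*\psi$ infer $\Gamma\vdash_*\varphi\to\psi$) is compatible with $j$ if and only if $\varphi\to j\psi\vdash_* j(\varphi\to\psi)$ for all formulas $\varphi,\psi$. (ii) In the first-order setting, with $j$ a nucleus on $\vdash_*^Q$: if $j$ is compatible with substitution, then the rule R$\forall$ is compatible with $j$ if and only if $\forall x\, j\varphi\vdash_*^Q j\forall x\varphi$ for all formulas $\varphi$ and variables $x$.
   Context: $S$ is a set of propositional (resp. first-order predicate) formulas containing $\top,\bot$ and closed under $\vee,\wedge,\to,\neg$ (and, in the predicate case, under $\forall,\exists$). An entailment relation on $S$ is a relation ${\rhd}\subseteq\mathrm{Fin}(S)\times S$ (finite sets of formulas $\Gamma$ on the left) satisfying: (R) if $\varphi\in\Gamma$ then $\Gamma\rhd\varphi$; (T) if $\Gamma\rhd\psi$ and $\Gamma',\psi\rhd\varphi$ then $\Gamma,\Gamma'\rhd\varphi$; (M) if $\Gamma\rhd\varphi$ then $\Gamma,\Gamma'\rhd\varphi$ (commas denote union). Positive logic $\vdash_p$ is the least entailment relation $\rhd$ satisfying rule R$\to$ (if $\Gamma,\varphi\rhd\psi$ then $\Gamma\rhd\varphi\to\psi$) and the axioms $\varphi,\psi\rhd\varphi\wedge\psi$; $\varphi\wedge\psi\rhd\varphi$; $\varphi\wedge\psi\rhd\psi$; $\varphi\rhd\varphi\vee\psi$;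 $\psi\rhd\varphi\vee\psi$; $\varphi\vee\psi,\varphi\to\delta,\psi\to\delta\rhd\delta$; $\varphi,\varphi\to\psi\rhd\psi$; $\emptyset\rhd\top$. "$\vdash_p$ plus additional axioms" is the least entailment relation satisfying these axioms and rule and the additional axioms. $\vdash_*^Q$ ($\vdash_*$ plus quantifiers) is obtained by adding to the inductive definition the rules: L$\forall$: from $\varphi[t/x],\Gamma,\forall x\varphi\rhd\delta$ infer $\Gamma,\forall x\varphi\rhd\delta$; R$\forall$: from $\Gamma\rhd\varphi[y/x]$ infer $\Gamma\rhd\forall x\varphi$; L$\exists$: from $\Gamma,\varphi[y/x]\rhd\delta$ infer $\Gamma,\exists x\varphi\rhd\delta$; R$\exists$: from $\Gamma\rhd\varphi[t/x]$ infer $\Gamma\rhd\exists x\varphi$; where in R$\forall$ and L$\exists$ the variable $y$ is fresh. A nucleus on an entailment relation $\rhd$ is a map $j\colon S\to S$ with (L$j$) if $\Gamma,\varphi\rhd j\psi$ then $\Gamma,j\varphi\rhd j\psi$, and (R$j$) if $\Gamma\rhd\psi$ then $\Gamma\rhd j\psi$. $j$ is compatible with substitution if $j(\varphi[t/x])\equiv(j\varphi)[t/x]$. A rule holding for $\rhd$ is compatible with $j$ if it also holds for the relation $\rhd_j$ defined by $\Gamma\rhd_j\varphi$ iff $\Gamma\rhd j\varphi$. -}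

module Defs where

open import Data.Nat using (ℕ; zero; suc; _⊔_; _≡ᵇ_)
open import Data.Bool using (Bool; true; false; if_then_else_)
open import Data.List using (List; []; _∷_; _++_; [_]; foldr)
open import Data.Bool.ListAction using (any)
open import Data.Vec using (Vec)
import Data.Vec as V
open import Data.Product using (_×_)
open import Data.List.Membership.Propositional using (_∈_; _∉_)
open import Data.List.Relation.Binary.Subset.Propositional using (_⊆_)
open import Data.List.Relation.Unary.All using (All)
open import Relation.Nullary using (¬_)
open import Relation.Binary.PropositionalEquality using (_≡_)

-- Finite sets of formulas Γ are represented by lists; "Γ , Γ'" is _++_,
-- "Γ , φ" is φ ∷ Γ.  Since rule M is stated with list inclusion ⊆
-- (membership-wise), derivability only depends on the underlying set.

infixr 6 _∧ᵖ_
infixr 5 _∨ᵖ_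
infixr 4 _⇒ᵖ_

data PForm (A : Set) : Set where
  atom  : A → PForm A
  ⊤ᵖ ⊥ᵖ : PForm A
  _∧ᵖ_ _∨ᵖ_ _⇒ᵖ_ : PForm A → PForm A → PForm A
  ¬ᵖ_   : PForm A → PForm A

module _ {A : Set} (Ax : List (PForm A) → PForm A → Set) where

  infix 2 _⊢*_

  data _⊢*_ : List (PForm A) → PForm A → Set where
    ax   : ∀ {Γ φ} → Ax Γ φ → Γ ⊢* φ
    R    : ∀ {Γ φ} → φ ∈ Γ → Γ ⊢* φ
    T    : ∀ {Γ Γ' ψ φ} → Γ ⊢* ψ → (ψ ∷ Γ') ⊢* φ → (Γ ++ Γ') ⊢* φ
    M    : ∀ {Γ Δ φ} → Γ ⊆ Δ → Γ ⊢* φ → Δ ⊢* φ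
    R⇒   : ∀ {Γ φ ψ} → (φ ∷ Γ) ⊢* ψ → Γ ⊢* (φ ⇒ᵖ ψ)
    ∧I   : ∀ {φ ψ} → (φ ∷ ψ ∷ []) ⊢* (φ ∧ᵖ ψ)
    ∧E₁  : ∀ {φ ψ} → [ φ ∧ᵖ ψ ] ⊢* φ
    ∧E₂  : ∀ {φ ψ} → [ φ ∧ᵖ ψ ] ⊢* ψ
    ∨I₁  : ∀ {φ ψ} → [ φ ] ⊢* (φ ∨ᵖ ψ)
    ∨I₂  : ∀ {φ ψ} → [ ψ ] ⊢* (φ ∨ᵖ ψ)
    ∨E   : ∀ {φ ψ δ} → ((φ ∨ᵖ ψ) ∷ (φ ⇒ᵖ δ) ∷ (ψ ⇒ᵖ δ) ∷ []) ⊢* δ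
    MP   : ∀ {φ ψ} → (φ ∷ (φ ⇒ᵖ ψ) ∷ []) ⊢* ψ
    ⊤I   : [] ⊢* ⊤ᵖ

  IsNucleusᵖ : (PForm A → PForm A) → Set
  IsNucleusᵖ j =
    (∀ Γ φ ψ → (φ ∷ Γ) ⊢* j ψ → (j φ ∷ Γ) ⊢* j ψ)
    × (∀ Γ ψ → Γ ⊢* ψ → Γ ⊢* j ψ)

  -- the rule R→ is compatible with j (holds for ▷_j)
  R⇒-Compatible : (PForm A → PForm A) → Set
  R⇒-Compatible j = ∀ Γ φ ψ → (φ ∷ Γ) ⊢* j ψ → Γ ⊢* j (φ ⇒ᵖ ψ)

record Signature : Set₁ where
  field
    Fun    : Set
    Pred   : Set
    arityF : Fun → ℕ
    arityP : Pred → ℕ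

module FO (Σ : Signature) where
  open Signature Σ

  Var : Set
  Var = ℕ

  data Term : Set where
    var : Var → Term
    app : (f : Fun) → Vec Term (arityF f) → Term

  infixr 6 _∧_
  infixr 5 _∨ᶠ_
  infixr 4 _⇒_

  data Form : Set where
    rel   : (P : Pred) → Vec Term (arityP P) → Form
    ⊤ᶠ ⊥ᶠ : Form
    _∧_ _∨ᶠ_ _⇒_ : Form → Form → Form
    ¬ᶠ_   : Form → Form
    ∀' ∃' : Var → Form → Form

  mutual
    fvT : Term → List Var
    fvT (var x)    = [ x ]
    fvT (app f ts) = fvTs ts

    fvTs : ∀ {n} → Vec Term n → List Var
    fvTs V.[]       = []
    fvTs (t V.∷ ts) = fvT t ++ fvTs ts

  remove : Var → List Var → List Var
  remove x []       = []
  remove x (y ∷ ys) = if y ≡ᵇ x then remove x ys else y ∷ remove x ys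

  fv : Form → List Var
  fv (rel P ts) = fvTs ts
  fv ⊤ᶠ         = []
  fv ⊥ᶠ         = []
  fv (φ ∧ ψ)    = fv φ ++ fv ψ
  fv (φ ∨ᶠ ψ)   = fv φ ++ fv ψ
  fv (φ ⇒ ψ)    = fv φ ++ fv ψ
  fv (¬ᶠ φ)     = fv φ
  fv (∀' x φ)   = remove x (fv φ)
  fv (∃' x φ)   = remove x (fv φ)

  fvs : List Form → List Var
  fvs []      = []
  fvs (φ ∷ Γ) = fv φ ++ fvs Γ

  Subst : Set
  Subst = Var → Term

  _[_↦_] : Subst → Var → Term → Subst
  (σ [ x ↦ t ]) y = if y ≡ᵇ x then t else σ y

  mutual
    substT : Subst → Term → Term
    substT σ (var x)    = σ x
    substT σ (app f ts) = app f (substTs σ ts)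

    substTs : ∀ {n} → Subst → Vec Term n → Vec Term n
    substTs σ V.[]       = V.[]
    substTs σ (t V.∷ ts) = substT σ t V.∷ substTs σ ts

  elemᵇ : Var → List Var → Bool
  elemᵇ x = any (λ y → y ≡ᵇ x)

  maxList : List Var → Var
  maxList = foldr _⊔_ 0

  range : Subst → List Var → List Var
  range σ []       = []
  range σ (y ∷ ys) = fvT (σ y) ++ range σ ys

  -- capture-avoiding substitution: a bound variable x is kept unless it
  -- would capture a variable of a substituted term, in which case it is
  -- renamed to a variable larger than all of those.
  subst : Subst → Form → Form
  subst σ (rel P ts) = rel P (substTs σ ts)
  subst σ ⊤ᶠ         = ⊤ᶠ
  subst σ ⊥ᶠ         = ⊥ᶠ
  subst σ (φ ∧ ψ)    = subst σ φ ∧ subst σ ψ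
  subst σ (φ ∨ᶠ ψ)   = subst σ φ ∨ᶠ subst σ ψ
  subst σ (φ ⇒ ψ)    = subst σ φ ⇒ subst σ ψ
  subst σ (¬ᶠ φ)     = ¬ᶠ subst σ φ
  subst σ (∀' x φ)   =
    let rs = range σ (remove x (fv φ)) in
    if elemᵇ x rs
      then ∀' (suc (maxList rs)) (subst (σ [ x ↦ var (suc (maxList rs)) ]) φ)
      else ∀' x (subst (σ [ x ↦ var x ]) φ)
  subst σ (∃' x φ)   =
    let rs = range σ (remove x (fv φ)) in
    if elemᵇ x rs
      then ∃' (suc (maxList rs)) (subst (σ [ x ↦ var (suc (maxList rs)) ]) φ)
      else ∃' x (subst (σ [ x ↦ var x ]) φ)

  _[_/_] : Form → Term → Var → Form
  φ [ t / x ] = subst (var [ x ↦ t ]) φ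

  module _ (Ax : List Form → Form → Set) where

    infix 2 _⊢Q_

    data _⊢Q_ : List Form → Form → Set where
      ax   : ∀ {Γ φ} → Ax Γ φ → Γ ⊢Q φ
      R    : ∀ {Γ φ} → φ ∈ Γ → Γ ⊢Q φ
      T    : ∀ {Γ Γ' ψ φ} → Γ ⊢Q ψ → (ψ ∷ Γ') ⊢Q φ → (Γ ++ Γ') ⊢Q φ
      M    : ∀ {Γ Δ φ} → Γ ⊆ Δ → Γ ⊢Q φ → Δ ⊢Q φ
      R⇒   : ∀ {Γ φ ψ} → (φ ∷ Γ) ⊢Q ψ → Γ ⊢Q (φ ⇒ ψ)
      ∧I   : ∀ {φ ψ} → (φ ∷ ψ ∷ []) ⊢Q (φ ∧ ψ)
      ∧E₁  : ∀ {φ ψ} → [ φ ∧ ψ ] ⊢Q φ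
      ∧E₂  : ∀ {φ ψ} → [ φ ∧ ψ ] ⊢Q ψ
      ∨I₁  : ∀ {φ ψ} → [ φ ] ⊢Q (φ ∨ᶠ ψ)
      ∨I₂  : ∀ {φ ψ} → [ ψ ] ⊢Q (φ ∨ᶠ ψ)
      ∨E   : ∀ {φ ψ δ} → ((φ ∨ᶠ ψ) ∷ (φ ⇒ δ) ∷ (ψ ⇒ δ) ∷ []) ⊢Q δ
      MP   : ∀ {φ ψ} → (φ ∷ (φ ⇒ ψ) ∷ []) ⊢Q ψ
      ⊤I   : [] ⊢Q ⊤ᶠ
      L∀   : ∀ {Γ φ x t δ} → (φ [ t / x ] ∷ ∀' x φ ∷ Γ) ⊢Q δ
                           → (∀' x φ ∷ Γ) ⊢Q δ
      R∀   : ∀ {Γ φ x y} → y ∉ fvs Γ → y ∉ fv (∀' x φ)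
                         → Γ ⊢Q φ [ var y / x ] → Γ ⊢Q ∀' x φ
      L∃   : ∀ {Γ φ x y δ} → y ∉ fvs Γ → y ∉ fv (∃' x φ) → y ∉ fv δ
                           → (φ [ var y / x ] ∷ Γ) ⊢Q δ
                           → (∃' x φ ∷ Γ) ⊢Q δ
      R∃   : ∀ {Γ φ x t} → Γ ⊢Q φ [ t / x ] → Γ ⊢Q ∃' x φ

    IsNucleusQ : (Form → Form) → Set
    IsNucleusQ j =
      (∀ Γ φ ψ → (φ ∷ Γ) ⊢Q j ψ → (j φ ∷ Γ) ⊢Q j ψ)
      × (∀ Γ ψ → Γ ⊢Q ψ → Γ ⊢Q j ψ)

    -- j(φ[t/x]) ≡ (jφ)[t/x]  (≡ read as syntactic identity)
    SubstCompatible : (Form → Form) → Set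
    SubstCompatible j = ∀ φ t x → j (φ [ t / x ]) ≡ (j φ) [ t / x ]

    -- the rule R∀ is compatible with j (holds for ▷_j)
    R∀-Compatible : (Form → Form) → Set
    R∀-Compatible j = ∀ Γ φ x y → y ∉ fvs Γ → y ∉ fv (∀' x φ)
                      → Γ ⊢Q j (φ [ var y / x ]) → Γ ⊢Q j (∀' x φ)

module Submission where

open import Defs
open import Data.Bool using (true; false; if_then_else_)
open import Data.Bool.Properties using (if-float)
open import Data.Empty using (⊥-elim)
open import Data.List using (List; []; _∷_; _++_; [_])
open import Data.List.Membership.Propositional using (_∈_; _∉_)
open import Data.List.Membership.Propositional.Properties using (∈-++⁺ˡ; ∈-++⁺ʳ; ∈-++⁻)
open import Data.List.Properties using (++-identityʳ)
open import Data.List.Relation.Unary.Any using (here; there)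
open import Data.Nat using (suc; _≡ᵇ_; _≤_; _≟_; s≤s)
open import Data.Nat.Properties using (m≤m⊔n; m≤n⇒m≤o⊔n; <⇒≢)
open import Data.Product using (_×_; _,_; map₁)
open import Data.Sum using (inj₁; inj₂)
open import Data.Vec using (Vec)
import Data.Vec as Vec
open import Function using (_∘_)
open import Function.Bundles using (_⇔_; mk⇔)
open import Relation.Nullary using (Reflects; ofʸ; ofⁿ; proof; yes; no)
open import Relation.Binary.PropositionalEquality
  using (_≡_; _≢_; refl; sym; trans; cong; cong₂)
import Relation.Binary.PropositionalEquality as ≡

-- Part (i) is pure rule bookkeeping: compatibility of R→, applied to the
-- instance  φ , φ → jψ ▷ jψ  of modus ponens, yields  φ → jψ ▷ j(φ → ψ);
-- conversely, from  Γ , φ ▷ jψ  rule R→ gives  Γ ▷ φ → jψ,  which is cut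
-- against that sequent.  Part (ii) runs the same way with L∀ (at t = x) and
-- R∀ in place of modus ponens and R→.  The one real point is the eigenvariable
-- condition when applying R∀ to jφ: compatibility with substitution forces j
-- to create no free variables, for if y is not free in φ then
-- (jφ)[t/y] = j(φ[t/y]) = jφ for every t, which is impossible when y is
-- free in jφ (take t a variable not occurring in jφ).

module Propositional {A : Set} (Ax : List (PForm A) → PForm A → Set) where

  infix 2 _⊢_

  _⊢_ : List (PForm A) → PForm A → Set
  _⊢_ = _⊢*_ Ax

  cut : ∀ {Γ ψ φ} → Γ ⊢ ψ → [ ψ ] ⊢ φ → Γ ⊢ φ
  cut {Γ} Γ⊢ψ ψ⊢φ = ≡.subst (_⊢ _) (++-identityʳ Γ) (T Γ⊢ψ ψ⊢φ)

  R⇒-Compatible⇔⇒j⊢j⇒ : ∀ j → R⇒-Compatible Ax j ⇔ (∀ φ ψ → [ φ ⇒ᵖ j ψ ] ⊢ j (φ ⇒ᵖ ψ))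
  R⇒-Compatible⇔⇒j⊢j⇒ j = mk⇔
    (λ compatible φ ψ → compatible [ φ ⇒ᵖ j ψ ] φ ψ MP)
    (λ ⇒j⊢j⇒ Γ φ ψ Γ,φ⊢jψ → cut (R⇒ Γ,φ⊢jψ) (⇒j⊢j⇒ φ ψ))

≡ᵇ-reflects : ∀ m n → Reflects (m ≡ n) (m ≡ᵇ n)
≡ᵇ-reflects m n = proof (m ≟ n)

module FirstOrder (Σ : Signature) where
  open FO Σ

  elemᵇ-reflects : ∀ x ys → Reflects (x ∈ ys) (elemᵇ x ys)
  elemᵇ-reflects x [] = ofⁿ λ ()
  elemᵇ-reflects x (y ∷ ys) with y ≡ᵇ x | ≡ᵇ-reflects y x
  ... | true  | ofʸ refl = ofʸ (here refl)
  ... | false | ofⁿ y≢x with elemᵇ x ys | elemᵇ-reflects x ys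
  ...   | true  | ofʸ x∈ys = ofʸ (there x∈ys)
  ...   | false | ofⁿ x∉ys = ofⁿ λ { (here refl) → y≢x refl ; (there x∈ys) → x∉ys x∈ys }

  ∈-remove⁻ : ∀ {v} x ys → v ∈ remove x ys → v ∈ ys × v ≢ x
  ∈-remove⁻ x (y ∷ ys) v∈ with y ≡ᵇ x | ≡ᵇ-reflects y x | v∈
  ... | true  | ofʸ refl | v∈′        = map₁ there (∈-remove⁻ x ys v∈′)
  ... | false | ofⁿ y≢x  | here refl  = here refl , y≢x
  ... | false | ofⁿ _    | there v∈′  = map₁ there (∈-remove⁻ x ys v∈′)

  ∈-remove⁺ : ∀ {v} x ys → v ∈ ys → v ≢ x → v ∈ remove x ys
  ∈-remove⁺ x (y ∷ ys) v∈ v≢x with y ≡ᵇ x | ≡ᵇ-reflects y x | v∈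
  ... | true  | ofʸ refl | here refl  = ⊥-elim (v≢x refl)
  ... | true  | ofʸ refl | there v∈ys = ∈-remove⁺ x ys v∈ys v≢x
  ... | false | ofⁿ _    | here refl  = here refl
  ... | false | ofⁿ _    | there v∈ys = there (∈-remove⁺ x ys v∈ys v≢x)

  ∉-remove : ∀ x ys → x ∉ remove x ys
  ∉-remove x ys x∈ = let _ , x≢x = ∈-remove⁻ x ys x∈ in x≢x refl

  ≤-maxList : ∀ {v} ys → v ∈ ys → v ≤ maxList ys
  ≤-maxList (y ∷ ys) (here refl)  = m≤m⊔n y (maxList ys)
  ≤-maxList (y ∷ ys) (there v∈ys) = m≤n⇒m≤o⊔n y (≤-maxList ys v∈ys)

  suc-maxList-∉ : ∀ ys → suc (maxList ys) ∉ ys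
  suc-maxList-∉ ys ∈ys = <⇒≢ (s≤s (≤-maxList ys ∈ys)) refl

  ∈-range : ∀ σ {v u} ys → v ∈ ys → u ∈ fvT (σ v) → u ∈ range σ ys
  ∈-range σ (y ∷ ys) (here refl)  u∈ = ∈-++⁺ˡ u∈
  ∈-range σ (y ∷ ys) (there v∈ys) u∈ = ∈-++⁺ʳ (fvT (σ y)) (∈-range σ ys v∈ys u∈)

  IdentityOn : Subst → List Var → Set
  IdentityOn σ vs = ∀ v → v ∈ vs → σ v ≡ var v

  range-⊆ : ∀ σ {u} ys → IdentityOn σ ys → u ∈ range σ ys → u ∈ ys
  range-⊆ σ (y ∷ ys) fixes u∈ with σ y | fixes y (here refl) | ∈-++⁻ (fvT (σ y)) u∈
  ... | _ | refl | inj₁ (here refl) = here refl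
  ... | _ | refl | inj₂ u∈ys        = there (range-⊆ σ ys (λ v → fixes v ∘ there) u∈ys)

  update-≡ : ∀ σ x t → (σ [ x ↦ t ]) x ≡ t
  update-≡ σ x t with x ≡ᵇ x | ≡ᵇ-reflects x x
  ... | true  | _      = refl
  ... | false | ofⁿ x≢x = ⊥-elim (x≢x refl)

  update-≢ : ∀ σ x t {v} → v ≢ x → (σ [ x ↦ t ]) v ≡ σ v
  update-≢ σ x t {v} v≢x with v ≡ᵇ x | ≡ᵇ-reflects v x
  ... | true  | ofʸ v≡x = ⊥-elim (v≢x v≡x)
  ... | false | _       = refl

  captured : Subst → Var → Form → List Var
  captured σ x φ = range σ (fv (∀' x φ))

  binder : Subst → Var → Form → Var
  binder σ x φ = if elemᵇ x (captured σ x φ) then suc (maxList (captured σ x φ)) else x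

  subst-∀' : ∀ σ x φ
           → subst σ (∀' x φ) ≡ ∀' (binder σ x φ) (subst (σ [ x ↦ var (binder σ x φ) ]) φ)
  subst-∀' σ x φ =
    sym (if-float (λ w → ∀' w (subst (σ [ x ↦ var w ]) φ)) (elemᵇ x (captured σ x φ)))

  subst-∃' : ∀ σ x φ
           → subst σ (∃' x φ) ≡ ∃' (binder σ x φ) (subst (σ [ x ↦ var (binder σ x φ) ]) φ)
  subst-∃' σ x φ =
    sym (if-float (λ w → ∃' w (subst (σ [ x ↦ var w ]) φ)) (elemᵇ x (captured σ x φ)))

  binder-∉-captured : ∀ σ x φ → binder σ x φ ∉ captured σ x φ
  binder-∉-captured σ x φ with elemᵇ x (captured σ x φ) | elemᵇ-reflects x (captured σ x φ)
  ... | true  | _       = suc-maxList-∉ (captured σ x φ)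
  ... | false | ofⁿ x∉ = x∉

  binder-of-id : ∀ σ x φ → IdentityOn σ (fv (∀' x φ)) → binder σ x φ ≡ x
  binder-of-id σ x φ fixes with elemᵇ x (captured σ x φ) | elemᵇ-reflects x (captured σ x φ)
  ... | true  | ofʸ x∈ = ⊥-elim (∉-remove x (fv φ) (range-⊆ σ _ fixes x∈))
  ... | false | _      = refl

  update-id : ∀ σ x φ → IdentityOn σ (fv (∀' x φ)) → IdentityOn (σ [ x ↦ var x ]) (fv φ)
  update-id σ x φ fixes v v∈ with v ≟ x
  ... | yes refl = update-≡ σ x (var x)
  ... | no v≢x   = trans (update-≢ σ x (var x) v≢x) (fixes v (∈-remove⁺ x (fv φ) v∈ v≢x))

  IdentityOn-++ˡ : ∀ {σ} us {vs} → IdentityOn σ (us ++ vs) → IdentityOn σ us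
  IdentityOn-++ˡ us fixes v = fixes v ∘ ∈-++⁺ˡ

  IdentityOn-++ʳ : ∀ {σ} us {vs} → IdentityOn σ (us ++ vs) → IdentityOn σ vs
  IdentityOn-++ʳ us fixes v = fixes v ∘ ∈-++⁺ʳ us

  mutual
    substT-id : ∀ σ t → IdentityOn σ (fvT t) → substT σ t ≡ t
    substT-id σ (var x)    fixes = fixes x (here refl)
    substT-id σ (app f ts) fixes = cong (app f) (substTs-id σ ts fixes)

    substTs-id : ∀ {n} σ (ts : Vec Term n) → IdentityOn σ (fvTs ts) → substTs σ ts ≡ ts
    substTs-id σ Vec.[]       fixes = refl
    substTs-id σ (t Vec.∷ ts) fixes = cong₂ Vec._∷_
      (substT-id σ t (IdentityOn-++ˡ (fvT t) fixes)) (substTs-id σ ts (IdentityOn-++ʳ (fvT t) fixes))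

  subst-id : ∀ σ φ → IdentityOn σ (fv φ) → subst σ φ ≡ φ
  subst-id σ (rel P ts) fixes = cong (rel P) (substTs-id σ ts fixes)
  subst-id σ ⊤ᶠ         fixes = refl
  subst-id σ ⊥ᶠ         fixes = refl
  subst-id σ (φ ∧ ψ)    fixes = cong₂ _∧_
    (subst-id σ φ (IdentityOn-++ˡ (fv φ) fixes)) (subst-id σ ψ (IdentityOn-++ʳ (fv φ) fixes))
  subst-id σ (φ ∨ᶠ ψ)   fixes = cong₂ _∨ᶠ_
    (subst-id σ φ (IdentityOn-++ˡ (fv φ) fixes)) (subst-id σ ψ (IdentityOn-++ʳ (fv φ) fixes))
  subst-id σ (φ ⇒ ψ)    fixes = cong₂ _⇒_
    (subst-id σ φ (IdentityOn-++ˡ (fv φ) fixes)) (subst-id σ ψ (IdentityOn-++ʳ (fv φ) fixes))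
  subst-id σ (¬ᶠ φ)     fixes = cong ¬ᶠ_ (subst-id σ φ fixes)
  subst-id σ (∀' x φ)   fixes rewrite subst-∀' σ x φ | binder-of-id σ x φ fixes =
    cong (∀' x) (subst-id (σ [ x ↦ var x ]) φ (update-id σ x φ fixes))
  subst-id σ (∃' x φ)   fixes rewrite subst-∃' σ x φ | binder-of-id σ x φ fixes =
    cong (∃' x) (subst-id (σ [ x ↦ var x ]) φ (update-id σ x φ fixes))

  mutual
    fvT-substT : ∀ σ t {v u} → v ∈ fvT t → u ∈ fvT (σ v) → u ∈ fvT (substT σ t)
    fvT-substT σ (var x)    (here refl) u∈ = u∈
    fvT-substT σ (app f ts) v∈          u∈ = fvTs-substTs σ ts v∈ u∈

    fvTs-substTs : ∀ {n} σ (ts : Vec Term n) {v u}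
                 → v ∈ fvTs ts → u ∈ fvT (σ v) → u ∈ fvTs (substTs σ ts)
    fvTs-substTs σ (t Vec.∷ ts) v∈ u∈ with ∈-++⁻ (fvT t) v∈
    ... | inj₁ v∈t  = ∈-++⁺ˡ (fvT-substT σ t v∈t u∈)
    ... | inj₂ v∈ts = ∈-++⁺ʳ (fvT (substT σ t)) (fvTs-substTs σ ts v∈ts u∈)

  mutual
    fv-subst : ∀ σ φ {v u} → v ∈ fv φ → u ∈ fvT (σ v) → u ∈ fv (subst σ φ)
    fv-subst σ (rel P ts) v∈ u∈ = fvTs-substTs σ ts v∈ u∈
    fv-subst σ (φ ∧ ψ)    v∈ u∈ = fv-subst-++ σ φ ψ v∈ u∈
    fv-subst σ (φ ∨ᶠ ψ)   v∈ u∈ = fv-subst-++ σ φ ψ v∈ u∈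
    fv-subst σ (φ ⇒ ψ)    v∈ u∈ = fv-subst-++ σ φ ψ v∈ u∈
    fv-subst σ (¬ᶠ φ)     v∈ u∈ = fv-subst σ φ v∈ u∈
    fv-subst σ (∀' x φ)   v∈ u∈ rewrite subst-∀' σ x φ = fv-subst-binder σ x φ v∈ u∈
    fv-subst σ (∃' x φ)   v∈ u∈ rewrite subst-∃' σ x φ = fv-subst-binder σ x φ v∈ u∈

    fv-subst-++ : ∀ σ φ ψ {v u} → v ∈ fv φ ++ fv ψ → u ∈ fvT (σ v)
                → u ∈ fv (subst σ φ) ++ fv (subst σ ψ)
    fv-subst-++ σ φ ψ v∈ u∈ with ∈-++⁻ (fv φ) v∈
    ... | inj₁ v∈φ = ∈-++⁺ˡ (fv-subst σ φ v∈φ u∈)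
    ... | inj₂ v∈ψ = ∈-++⁺ʳ (fv (subst σ φ)) (fv-subst σ ψ v∈ψ u∈)

    fv-subst-binder : ∀ σ x φ {v u} → v ∈ fv (∀' x φ) → u ∈ fvT (σ v)
                    → u ∈ remove (binder σ x φ) (fv (subst (σ [ x ↦ var (binder σ x φ) ]) φ))
    fv-subst-binder σ x φ {v} {u} v∈ u∈ =
      let v∈φ , v≢x = ∈-remove⁻ x (fv φ) v∈
          u∈σ′v = ≡.subst (λ s → u ∈ fvT s) (sym (update-≢ σ x _ v≢x)) u∈
      in ∈-remove⁺ (binder σ x φ) _ (fv-subst _ φ v∈φ u∈σ′v)
           (λ { refl → binder-∉-captured σ x φ (∈-range σ _ v∈ u∈) })

  subst-fresh : ∀ φ y t → y ∉ fv φ → φ [ t / y ] ≡ φ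
  subst-fresh φ y t y∉ = subst-id _ φ (λ v v∈ → update-≢ var y t λ { refl → y∉ v∈ })

  fv-[/] : ∀ ψ y t {u} → y ∈ fv ψ → u ∈ fvT t → u ∈ fv (ψ [ t / y ])
  fv-[/] ψ y t {u} y∈ u∈ =
    fv-subst (var [ y ↦ t ]) ψ y∈ (≡.subst (λ s → u ∈ fvT s) (sym (update-≡ var y t)) u∈)

  subst-invariant⇒∉fv : ∀ ψ y → (∀ t → ψ [ t / y ] ≡ ψ) → y ∉ fv ψ
  subst-invariant⇒∉fv ψ y invariant y∈ =
    let z = suc (maxList (fv ψ))
        z∈ψ[z/y] = fv-[/] ψ y (var z) y∈ (here refl)
    in suc-maxList-∉ (fv ψ) (≡.subst (λ χ → z ∈ fv χ) (invariant (var z)) z∈ψ[z/y])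

  module _ (Ax : List Form → Form → Set) where

    infix 2 _⊢_

    _⊢_ : List Form → Form → Set
    _⊢_ = _⊢Q_ Ax

    cut : ∀ {Γ ψ φ} → Γ ⊢ ψ → [ ψ ] ⊢ φ → Γ ⊢ φ
    cut {Γ} Γ⊢ψ ψ⊢φ = ≡.subst (_⊢ _) (++-identityʳ Γ) (T Γ⊢ψ ψ⊢φ)

    module _ (j : Form → Form) (compatible : SubstCompatible Ax j) where

      ∉fv-j : ∀ φ y → y ∉ fv φ → y ∉ fv (j φ)
      ∉fv-j φ y y∉ = subst-invariant⇒∉fv (j φ) y λ t →
        trans (sym (compatible φ t y)) (cong j (subst-fresh φ y t y∉))

      ∉fv-∀'-j : ∀ φ x y → y ∉ fv (∀' x φ) → y ∉ fv (∀' x (j φ))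
      ∉fv-∀'-j φ x y y∉ y∈ =
        let y∈jφ , y≢x = ∈-remove⁻ x (fv (j φ)) y∈
        in ∉fv-j φ y (λ y∈φ → y∉ (∈-remove⁺ x (fv φ) y∈φ y≢x)) y∈jφ

      R∀-Compatible⇔∀j⊢j∀ : R∀-Compatible Ax j ⇔ (∀ φ x → [ ∀' x (j φ) ] ⊢ j (∀' x φ))
      R∀-Compatible⇔∀j⊢j∀ = mk⇔ instantiate generalise
        where
        instantiate : R∀-Compatible Ax j → ∀ φ x → [ ∀' x (j φ) ] ⊢ j (∀' x φ)
        instantiate R∀-compatible φ x =
          R∀-compatible [ ∀' x (j φ) ] φ x x x∉ (∉-remove x (fv φ)) ∀'jφ⊢j[φ[x/x]]
          where
          x∉ : x ∉ fvs [ ∀' x (j φ) ]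
          x∉ = ∉-remove x (fv (j φ)) ∘ ≡.subst (x ∈_) (++-identityʳ _)

          ∀'jφ⊢j[φ[x/x]] : [ ∀' x (j φ) ] ⊢ j (φ [ var x / x ])
          ∀'jφ⊢j[φ[x/x]] =
            ≡.subst ([ ∀' x (j φ) ] ⊢_) (sym (compatible φ (var x) x)) (L∀ (R (here refl)))

        generalise : (∀ φ x → [ ∀' x (j φ) ] ⊢ j (∀' x φ)) → R∀-Compatible Ax j
        generalise ∀'j⊢j∀' Γ φ x y y∉Γ y∉∀'φ Γ⊢j[φ[y/x]] =
          cut (R∀ y∉Γ (∉fv-∀'-j φ x y y∉∀'φ) Γ⊢[jφ][y/x]) (∀'j⊢j∀' φ x)
          where
          Γ⊢[jφ][y/x] : Γ ⊢ (j φ) [ var y / x ]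
          Γ⊢[jφ][y/x] = ≡.subst (Γ ⊢_) (compatible φ (var y) x) Γ⊢j[φ[y/x]]

lemma5p1 :
    ((A : Set) (Ax : List (PForm A) → PForm A → Set) (j : PForm A → PForm A)
      → IsNucleusᵖ Ax j
      → (R⇒-Compatible Ax j
          ⇔ (∀ φ ψ → _⊢*_ Ax [ φ ⇒ᵖ j ψ ] (j (φ ⇒ᵖ ψ)))))
  × ((Σ : Signature) (Ax : List (FO.Form Σ) → FO.Form Σ → Set)
      (j : FO.Form Σ → FO.Form Σ)
      → FO.IsNucleusQ Σ Ax j
      → FO.SubstCompatible Σ Ax j
      → (FO.R∀-Compatible Σ Ax j
          ⇔ (∀ φ x → FO._⊢Q_ Σ Ax [ FO.∀' x (j φ) ] (j (FO.∀' x φ)))))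
lemma5p1 =
    (λ A Ax j _ → Propositional.R⇒-Compatible⇔⇒j⊢j⇒ Ax j)
  , (λ Σ Ax j _ compatible → FirstOrder.R∀-Compatible⇔∀j⊢j∀ Σ Ax j compatible)
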